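{- Let $p > 3$ be a prime and let $J$ be a sequence of elements of $(\mathbb{Z}/p\mathbb{Z})^3$ with $|J| \in \{4p-3, 4p-2, 4p-1\}$. Then $$1 - (p \mid J) + (2p \mid J) - (3p \mid J) \equiv 0 \pmod p.$$
   Context: A sequence is a finite list of elements (repetitions allowed); a subsequence is obtained by selecting any subset of the positions (not necessarily consecutive), and it is zero-sum if its terms sum to $0$. For a sequence $J$ and an integer $k \geq 1$, $(k \mid J)$ denotes the number of zero-sum subsequences of $J$ of length $k$, i.e. the number of $k$-element subsets of the index set of $J$ whose corresponding terms sum to $0$. -}

module Defs where

open import Data.Nat using (ℕ; zero; suc; _+_; _%_; NonZero)
open import Data.Fin using (Fin; toℕ)
open import Data.Product using (_×_; _,_)
open import Data.List using (List; []; _∷_; map; _++_; length; filter; sum)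
open import Data.Bool using (Bool; true; false; _∧_)
open import Relation.Binary.PropositionalEquality using (_≡_)

Elem3 : ℕ → Set
Elem3 p = Fin p × Fin p × Fin p

-- All subsequences of a list, one for each subset of the index set
-- (so repeated terms at different positions give distinct subsequences).
subseqs : {A : Set} → List A → List (List A)
subseqs []       = [] ∷ []
subseqs (x ∷ xs) = let r = subseqs xs in r ++ map (x ∷_) r

sumCoords : {p : ℕ} → List (Elem3 p) → ℕ × ℕ × ℕ
sumCoords []                   = 0 , 0 , 0
sumCoords ((a , b , c) ∷ xs) with sumCoords xs
... | (s , t , u) = toℕ a + s , toℕ b + t , toℕ c + u

isZero : ℕ → (p : ℕ) → .{{NonZero p}} → Bool
isZero n p with n % p
... | zero  = true
... | suc _ = false

isZeroSum : (p : ℕ) → .{{NonZero p}} → List (Elem3 p) → Bool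
isZeroSum p xs with sumCoords xs
... | (s , t , u) = isZero s p ∧ isZero t p ∧ isZero u p

eqℕ : ℕ → ℕ → Bool
eqℕ zero    zero    = true
eqℕ zero    (suc _) = false
eqℕ (suc _) zero    = false
eqℕ (suc m) (suc n) = eqℕ m n

countB : {A : Set} → (A → Bool) → List A → ℕ
countB f []       = 0
countB f (x ∷ xs) with f x
... | true  = suc (countB f xs)
... | false = countB f xs

-- (k ∣ J): number of zero-sum subsequences of J of length k.
zsCount : (p : ℕ) → .{{NonZero p}} → ℕ → List (Elem3 p) → ℕ
zsCount p k J = countB (λ S → eqℕ (length S) k ∧ isZeroSum p S) (subseqs J)

module Submission where

open import Defs
open import Data.Nat using (ℕ; _*_; _∸_; _>_; NonZero)
open import Data.Nat.Primality using (Prime)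
open import Data.Integer using (ℤ; +_; _-_; _+_)
open import Data.Integer.Divisibility using (_∣_)
open import Data.List using (List; length)
open import Data.Sum using (_⊎_)
open import Relation.Binary.PropositionalEquality using (_≡_)

open import Data.Bool using (Bool; true; false; _∧_)
open import Data.Bool.Properties using (∧-zeroʳ; ∧-identityʳ)
open import Data.Empty using (⊥-elim)
open import Data.Fin using (toℕ)
open import Data.Integer using (-_; -1ℤ; 0ℤ; 1ℤ; _^_; ∣_∣) renaming (_*_ to _·_)
import Data.Integer.Properties as ℤ
open import Data.Integer.Divisibility.Signed
  using (divides; ∣m∣n⇒∣m+n; ∣m⇒∣-m; ∣n⇒∣m*n; ∣m⇒∣m*n; ∣⇒∣ᵤ; ∣ᵤ⇒∣)
  renaming (_∣_ to _∣ˢ_)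
open import Data.Integer.Tactic.RingSolver using (solve-∀)
open import Data.List using ([]; _∷_; _++_; map)
open import Data.List.Relation.Unary.All using (All; []; _∷_)
open import Data.Nat as ℕ using (zero; suc; pred; _≤_; _<_; z≤n; s≤s; _%_; _/_; _!)
import Data.Nat.Properties as ℕₚ
import Data.Nat.Divisibility as ℕ∣
open import Data.Nat.DivMod using (m≡m%n+[m/n]*n; m%n<n; m*n%n≡0)
open import Data.Nat.Primality using (euclidsLemma; prime⇒irreducible; ¬prime[1])
open import Data.Product using (_×_; _,_; proj₁; proj₂; map₂; Σ-syntax)
open import Data.Sum using (inj₁; inj₂) renaming (map to ⊎-map)
open import Data.Unit using (⊤; tt)
open import Relation.Nullary using (¬_)
open import Relation.Binary.PropositionalEquality
  using (_≢_; refl; sym; trans; cong; cong₂; subst; module ≡-Reasoning)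

-- Proof idea (a Chevalley–Warning argument over the subsets of J).
--
-- Write p = q + 1 and, for a subsequence S of J, let σ₁(S), σ₂(S), σ₃(S) be its
-- coordinate sums and σ₄(S) = |S|; all four are affine in the indicator
-- variables of S.  The polynomial P(z) = (z-1)(z-2)⋯(z-q) satisfies
-- P(z) ≡ P(0)·[p ∣ z] (mod p), and p ∤ P(0) = ±q!.  Hence
--   M(S) = P(σ₁ S)·P(σ₂ S)·P(σ₃ S)·P(σ₄ S) ≡ P(0)⁴·[S zero-sum ∧ p ∣ |S|] (mod p),
-- and M has degree 4q < |J| in the indicator variables, so its alternating sum
-- Σ_S (-1)^|S| M(S) vanishes (an iterated finite difference of too high order).
-- Therefore p divides Σ_S (-1)^|S| [S zero-sum ∧ p ∣ |S|].  Since |S| ≤ |J| < 4p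
-- and p is odd, this alternating sum is exactly 1 - (p∣J) + (2p∣J) - (3p∣J).

ind : Bool → ℤ
ind true  = 1ℤ
ind false = 0ℤ

ind-∧ : ∀ a b → ind (a ∧ b) ≡ ind a · ind b
ind-∧ true  b = sym (ℤ.*-identityˡ (ind b))
ind-∧ false b = refl

sign : ℕ → ℤ
sign n = -1ℤ ^ n

-- Congruence of integers modulo k (a record, so that a and b are inferable).
infix 4 _≡_[mod_]
record _≡_[mod_] (a b k : ℤ) : Set where
  constructor mod
  field divides-difference : k ∣ˢ (a - b)
open _≡_[mod_]

·shift-mod : ∀ {k a a' b b'} → a ≡ a' [mod k ] → b ≡ b' [mod k ] → a · b ≡ a' · b' [mod k ]
·shift-mod {k} {a} {a'} {b} {b'} (mod k∣a-a') (mod k∣b-b') =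
  mod (subst (k ∣ˢ_) (sym (difference a b a' b')) (∣m∣n⇒∣m+n (∣n⇒∣m*n a k∣b-b') (∣m⇒∣m*n b' k∣a-a')))
  where
  difference : ∀ a b a' b' → a · b - a' · b' ≡ a · (b - b') + (a - a') · b'
  difference = solve-∀

shift-mod : ∀ {k a b} c → a ≡ b [mod k ] → a - c ≡ b - c [mod k ]
shift-mod {k} {a} {b} c (mod k∣a-b) = mod (subst (k ∣ˢ_) (sym (shift a b c)) k∣a-b)
  where
  shift : ∀ a b c → (a - c) - (b - c) ≡ a - b
  shift = solve-∀

module Subsequences {A : Set} where

  Σsub : List A → (List A → ℤ) → ℤ
  Σsub []       F = F []
  Σsub (x ∷ xs) F = Σsub xs F + Σsub xs (λ S → F (x ∷ S))

  Σsub-cong : ∀ J {F G} → (∀ S → length S ≤ length J → F S ≡ G S) → Σsub J F ≡ Σsub J G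
  Σsub-cong []       F≡G = F≡G [] z≤n
  Σsub-cong (x ∷ xs) F≡G =
    cong₂ _+_ (Σsub-cong xs (λ S S≤ → F≡G S (ℕₚ.m≤n⇒m≤1+n S≤)))
              (Σsub-cong xs (λ S S≤ → F≡G (x ∷ S) (s≤s S≤)))

  Σsub-zero : ∀ J → Σsub J (λ _ → 0ℤ) ≡ 0ℤ
  Σsub-zero []       = refl
  Σsub-zero (x ∷ xs) = cong₂ _+_ (Σsub-zero xs) (Σsub-zero xs)

  Σsub-+ : ∀ J F G → Σsub J (λ S → F S + G S) ≡ Σsub J F + Σsub J G
  Σsub-+ []       F G = refl
  Σsub-+ (x ∷ xs) F G =
    trans (cong₂ _+_ (Σsub-+ xs F G) (Σsub-+ xs (λ S → F (x ∷ S)) (λ S → G (x ∷ S))))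
          (interchange (Σsub xs F) (Σsub xs G) (Σsub xs (λ S → F (x ∷ S))) (Σsub xs (λ S → G (x ∷ S))))
    where
    interchange : ∀ a b c d → (a + b) + (c + d) ≡ (a + c) + (b + d)
    interchange = solve-∀

  Σsub-neg : ∀ J F → Σsub J (λ S → - F S) ≡ - Σsub J F
  Σsub-neg []       F = refl
  Σsub-neg (x ∷ xs) F =
    trans (cong₂ _+_ (Σsub-neg xs F) (Σsub-neg xs (λ S → F (x ∷ S))))
          (sym (ℤ.neg-distrib-+ (Σsub xs F) (Σsub xs (λ S → F (x ∷ S)))))

  Σsub-- : ∀ J F G → Σsub J (λ S → F S - G S) ≡ Σsub J F - Σsub J G
  Σsub-- J F G = trans (Σsub-+ J F (λ S → - G S)) (cong (λ n → Σsub J F + n) (Σsub-neg J G))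

  Σsub-scale : ∀ J c F → Σsub J (λ S → c · F S) ≡ c · Σsub J F
  Σsub-scale []       c F = refl
  Σsub-scale (x ∷ xs) c F =
    trans (cong₂ _+_ (Σsub-scale xs c F) (Σsub-scale xs c (λ S → F (x ∷ S))))
          (sym (ℤ.*-distribˡ-+ c (Σsub xs F) (Σsub xs (λ S → F (x ∷ S)))))

  Σsub-divisible : ∀ J k F → (∀ S → k ∣ˢ F S) → k ∣ˢ Σsub J F
  Σsub-divisible []       k F k∣F = k∣F []
  Σsub-divisible (x ∷ xs) k F k∣F =
    ∣m∣n⇒∣m+n (Σsub-divisible xs k F k∣F) (Σsub-divisible xs k (λ S → F (x ∷ S)) (λ S → k∣F (x ∷ S)))

  Σsub-empty : ∀ J → Σsub J (λ S → ind (eqℕ (length S) 0)) ≡ 1ℤ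
  Σsub-empty []       = refl
  Σsub-empty (x ∷ xs) = cong₂ _+_ (Σsub-empty xs) (Σsub-zero xs)

  Δ : A → (List A → ℤ) → List A → ℤ
  Δ x F S = F (x ∷ S) - F S

  ConstBelow : ℕ → ℤ → Set
  ConstBelow zero    c = c ≡ 0ℤ
  ConstBelow (suc d) c = ⊤

  -- DegBelow d J F: as a function of which terms of J are selected, F is a
  -- polynomial of degree < d (its derivatives of order d all vanish).
  DegBelow : ℕ → List A → (List A → ℤ) → Set
  DegBelow d []       F = ConstBelow d (F [])
  DegBelow d (x ∷ xs) F = DegBelow d xs F × DegBelow (pred d) xs (Δ x F)

  Deg-cong : ∀ d J {F G} → (∀ S → F S ≡ G S) → DegBelow d J F → DegBelow d J G
  Deg-cong zero    []       F≡G D = trans (sym (F≡G [])) D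
  Deg-cong (suc d) []       F≡G D = tt
  Deg-cong d       (x ∷ xs) F≡G (D , D') =
    Deg-cong d xs F≡G D , Deg-cong (pred d) xs (λ S → cong₂ _-_ (F≡G (x ∷ S)) (F≡G S)) D'

  Deg-mono : ∀ {d e} J (F : List A → ℤ) → d ≤ e → DegBelow d J F → DegBelow e J F
  Deg-mono {zero}  {zero}  []       F d≤e D = D
  Deg-mono {zero}  {suc e} []       F d≤e D = tt
  Deg-mono {suc d} {suc e} []       F d≤e D = tt
  Deg-mono         (x ∷ xs) F d≤e (D , D') =
    Deg-mono xs F d≤e D , Deg-mono xs (Δ x F) (ℕₚ.pred-mono-≤ d≤e) D'

  Deg-zero : ∀ d J → DegBelow d J (λ _ → 0ℤ)
  Deg-zero zero    []       = refl
  Deg-zero (suc d) []       = tt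
  Deg-zero d       (x ∷ xs) = Deg-zero d xs , Deg-zero (pred d) xs

  Deg-const : ∀ J c → DegBelow 1 J (λ _ → c)
  Deg-const []       c = tt
  Deg-const (x ∷ xs) c = Deg-const xs c , Deg-cong 0 xs (λ _ → sym (ℤ.+-inverseʳ c)) (Deg-zero 0 xs)

  Deg-+ : ∀ d J (F G : List A → ℤ) → DegBelow d J F → DegBelow d J G → DegBelow d J (λ S → F S + G S)
  Deg-+ zero    []       F G D E = cong₂ _+_ D E
  Deg-+ (suc d) []       F G D E = tt
  Deg-+ d       (x ∷ xs) F G (D , D') (E , E') =
    Deg-+ d xs F G D E ,
    Deg-cong (pred d) xs (λ S → sym (Δ-+ (F (x ∷ S)) (G (x ∷ S)) (F S) (G S)))
      (Deg-+ (pred d) xs (Δ x F) (Δ x G) D' E')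
    where
    Δ-+ : ∀ a b a' b' → (a + b) - (a' + b') ≡ (a - a') + (b - b')
    Δ-+ = solve-∀

  Deg-shift : ∀ d x xs (F : List A → ℤ) → DegBelow d (x ∷ xs) F → DegBelow d xs (λ S → F (x ∷ S))
  Deg-shift d x xs F (D , D') =
    Deg-cong d xs (λ S → restore (F (x ∷ S)) (F S))
      (Deg-+ d xs F (Δ x F) D (Deg-mono xs (Δ x F) (ℕₚ.pred[n]≤n {d}) D'))
    where
    restore : ∀ a b → b + (a - b) ≡ a
    restore = solve-∀

  Δ-· : ∀ x (F G : List A → ℤ) S → Δ x (λ T → F T · G T) S ≡ Δ x F S · G (x ∷ S) + F S · Δ x G S
  Δ-· x F G S = leibniz (F (x ∷ S)) (G (x ∷ S)) (F S) (G S)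
    where
    leibniz : ∀ a b a' b' → a · b - a' · b' ≡ (a - a') · b + a' · (b - b')
    leibniz = solve-∀

  Deg-zero-· : ∀ d J (F G : List A → ℤ) → DegBelow 0 J F → DegBelow d J (λ S → F S · G S)
  Deg-zero-· zero    []       F G D = cong (_· G []) D
  Deg-zero-· (suc d) []       F G D = tt
  Deg-zero-· d       (x ∷ xs) F G (D , D') =
    Deg-zero-· d xs F G D ,
    Deg-cong (pred d) xs (λ S → sym (Δ-· x F G S))
      (Deg-+ (pred d) xs _ _ (Deg-zero-· (pred d) xs (Δ x F) (λ S → G (x ∷ S)) D')
                             (Deg-zero-· (pred d) xs F (Δ x G) D))

  Deg-· : ∀ a b J (F G : List A → ℤ) → DegBelow a J F → DegBelow (suc b) J G → DegBelow (a ℕ.+ b) J (λ S → F S · G S)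
  Deg-· zero    b J        F G D E = Deg-zero-· b J F G D
  Deg-· (suc a) b []       F G D E = tt
  Deg-· (suc a) b (x ∷ xs) F G (D , D') (E , E') =
    Deg-· (suc a) b xs F G D E ,
    Deg-cong (a ℕ.+ b) xs (λ S → sym (Δ-· x F G S))
      (Deg-+ (a ℕ.+ b) xs _ _ (Deg-· a b xs (Δ x F) (λ S → G (x ∷ S)) D' (Deg-shift (suc b) x xs G (E , E'))) F·ΔG)
    where
    F·ΔG : DegBelow (a ℕ.+ b) xs (λ S → F S · Δ x G S)
    F·ΔG = subst (λ n → DegBelow n xs (λ S → F S · Δ x G S)) (ℕₚ.+-comm b a)
             (Deg-cong (b ℕ.+ a) xs (λ S → ℤ.*-comm (Δ x G S) (F S)) (Deg-· b a xs (Δ x G) F E' D))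

  Deg-affine : ∀ J (L : List A → ℤ) (c : A → ℤ) → (∀ x S → L (x ∷ S) ≡ c x + L S) → DegBelow 2 J L
  Deg-affine []       L c L-step = tt
  Deg-affine (x ∷ xs) L c L-step =
    Deg-affine xs L c L-step ,
    Deg-cong 1 xs (λ S → sym (trans (cong (_- L S) (L-step x S)) (cancel (c x) (L S)))) (Deg-const xs (c x))
    where
    cancel : ∀ a b → (a + b) - b ≡ a
    cancel = solve-∀

  -- The alternating sum of a polynomial of degree < |J| vanishes: each term of J
  -- turns it into minus the alternating sum of a derivative of lower degree.
  vanishing : ∀ d J F → DegBelow d J F → d ≤ length J → Σsub J (λ S → sign (length S) · F S) ≡ 0ℤ
  vanishing zero []       F D z≤n = cong (1ℤ ·_) D
  vanishing d    (x ∷ xs) F (D , D') d≤ = begin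
    Σsub xs (λ S → s S · F S) + Σsub xs (λ S → (-1ℤ · s S) · F (x ∷ S))
      ≡⟨ sym (Σsub-+ xs _ _) ⟩
    Σsub xs (λ S → s S · F S + (-1ℤ · s S) · F (x ∷ S))
      ≡⟨ Σsub-cong xs (λ S _ → step (s S) (F S) (F (x ∷ S))) ⟩
    Σsub xs (λ S → - (s S · Δ x F S))
      ≡⟨ Σsub-neg xs _ ⟩
    - Σsub xs (λ S → s S · Δ x F S)
      ≡⟨ cong -_ (vanishing (pred d) xs (Δ x F) D' (ℕₚ.pred-mono-≤ d≤)) ⟩
    0ℤ ∎
    where
    open ≡-Reasoning
    s : List A → ℤ
    s S = sign (length S)
    step : ∀ σ a b → σ · a + (-1ℤ · σ) · b ≡ - (σ · (b - a))
    step = solve-∀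

open Subsequences

countB-++ : ∀ {X : Set} (f : X → Bool) xs ys → countB f (xs ++ ys) ≡ countB f xs ℕ.+ countB f ys
countB-++ f []       ys = refl
countB-++ f (x ∷ xs) ys with f x
... | true  = cong suc (countB-++ f xs ys)
... | false = countB-++ f xs ys

countB-map : ∀ {X Y : Set} (f : Y → Bool) (g : X → Y) xs → countB f (map g xs) ≡ countB (λ x → f (g x)) xs
countB-map f g []       = refl
countB-map f g (x ∷ xs) with f (g x)
... | true  = cong suc (countB-map f g xs)
... | false = countB-map f g xs

count-Σsub : ∀ {A : Set} (f : List A → Bool) J → + countB f (subseqs J) ≡ Σsub J (λ S → ind (f S))
count-Σsub f [] with f []
... | true  = refl
... | false = refl
count-Σsub f (x ∷ xs) = begin
  + countB f (subseqs xs ++ map (x ∷_) (subseqs xs))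
    ≡⟨ cong +_ (countB-++ f (subseqs xs) _) ⟩
  + (countB f (subseqs xs) ℕ.+ countB f (map (x ∷_) (subseqs xs)))
    ≡⟨ ℤ.pos-+ (countB f (subseqs xs)) _ ⟩
  + countB f (subseqs xs) + + countB f (map (x ∷_) (subseqs xs))
    ≡⟨ cong₂ _+_ (count-Σsub f xs)
                 (trans (cong +_ (countB-map f (x ∷_) (subseqs xs))) (count-Σsub (λ S → f (x ∷ S)) xs)) ⟩
  Σsub xs (λ S → ind (f S)) + Σsub xs (λ S → ind (f (x ∷ S))) ∎
  where open ≡-Reasoning

prime∤! : ∀ {p} → Prime p → ∀ m → m < p → ¬ (p ℕ∣.∣ m !)
prime∤! pr zero    m<p p∣1 = ¬prime[1] (subst Prime (ℕ∣.∣1⇒≡1 p∣1) pr)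
prime∤! pr (suc m) m<p p∣m! with euclidsLemma (suc m) (m !) pr p∣m!
... | inj₁ p∣1+m = ℕₚ.<-irrefl refl (ℕₚ.<-≤-trans m<p (ℕ∣.∣⇒≤ p∣1+m))
... | inj₂ p∣m!  = prime∤! pr m (ℕₚ.<-trans (ℕₚ.n<1+n m) m<p) p∣m!

prime∣·⇒ : ∀ {p} → Prime p → ∀ a b → (+ p) ∣ˢ (a · b) → (+ p) ∣ˢ a ⊎ (+ p) ∣ˢ b
prime∣·⇒ pr a b p∣ab =
  ⊎-map ∣ᵤ⇒∣ ∣ᵤ⇒∣ (euclidsLemma ∣ a ∣ ∣ b ∣ pr (subst (_ ℕ∣.∣_) (ℤ.abs-* a b) (∣⇒∣ᵤ p∣ab)))

prime∣·-cancel : ∀ {p a b} → Prime p → ¬ ((+ p) ∣ˢ a) → (+ p) ∣ˢ (a · b) → (+ p) ∣ˢ b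
prime∣·-cancel {a = a} {b} pr p∤a p∣ab with prime∣·⇒ pr a b p∣ab
... | inj₁ p∣a = ⊥-elim (p∤a p∣a)
... | inj₂ p∣b = p∣b

sign-even : ∀ h → sign (h * 2) ≡ 1ℤ
sign-even h = trans (cong sign (ℕₚ.*-comm h 2)) (trans (sym (ℤ.^-*-assoc -1ℤ 2 h)) (ℤ.^-zeroˡ h))

sign-oddPrime : ∀ {p} → Prime p → 2 < p → sign p ≡ -1ℤ
sign-oddPrime {p} pr 2<p = by-parity (p % 2) refl
  where
  by-parity : ∀ r → p % 2 ≡ r → sign p ≡ -1ℤ
  by-parity 0 p%2 with prime⇒irreducible pr (ℕ∣.m%n≡0⇒n∣m p 2 p%2)
  ... | inj₁ ()
  ... | inj₂ 2≡p = ⊥-elim (ℕₚ.<-irrefl 2≡p 2<p)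
  by-parity 1 p%2 =
    trans (cong sign (trans (m≡m%n+[m/n]*n p 2) (cong (ℕ._+ (p / 2) * 2) p%2)))
          (cong (-1ℤ ·_) (sign-even (p / 2)))
  by-parity (suc (suc r)) p%2 with subst (_< 2) p%2 (m%n<n p 2)
  ... | s≤s (s≤s ())

module PolynomialMethod (q : ℕ) where

  p : ℕ
  p = suc q

  P : ℕ → ℤ → ℤ
  P zero    z = 1ℤ
  P (suc m) z = (z - + suc m) · P m z

  P-cong : ∀ m {k a b} → a ≡ b [mod k ] → P m a ≡ P m b [mod k ]
  P-cong zero    a≡b = mod (divides 0ℤ refl)
  P-cong (suc m) a≡b = ·shift-mod (shift-mod (+ suc m) a≡b) (P-cong m a≡b)

  P-root : ∀ m {k a} r → a ≡ + r [mod k ] → 1 ≤ r → r ≤ m → k ∣ˢ P m a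
  P-root zero    zero a≡r () z≤n
  P-root (suc m) {k} {a} r a≡r 1≤r r≤1+m with ℕₚ.m≤n⇒m<n∨m≡n r≤1+m
  ... | inj₁ (s≤s r≤m) = ∣n⇒∣m*n (a - + suc m) (P-root m r a≡r 1≤r r≤m)
  ... | inj₂ refl      = ∣m⇒∣m*n (P m a) (divides-difference a≡r)

  ∣P0∣ : ∀ m → ∣ P m 0ℤ ∣ ≡ m !
  ∣P0∣ zero    = refl
  ∣P0∣ (suc m) = trans (ℤ.abs-* (0ℤ - + suc m) (P m 0ℤ)) (cong (suc m ℕ.*_) (∣P0∣ m))

  residue : ∀ x → + x ≡ + (x % p) [mod + p ]
  residue x = mod (divides (+ (x / p)) (begin
    + x - + r                    ≡⟨ cong (λ n → + n - + r) (m≡m%n+[m/n]*n x p) ⟩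
    + (r ℕ.+ t * p) - + r         ≡⟨ cong (_- + r) (ℤ.pos-+ r (t * p)) ⟩
    (+ r + + (t * p)) - + r       ≡⟨ cong (λ n → (+ r + n) - + r) (ℤ.pos-* t p) ⟩
    (+ r + + t · + p) - + r       ≡⟨ cancel (+ r) (+ t · + p) ⟩
    + t · + p                     ∎))
    where
    open ≡-Reasoning
    r t : ℕ
    r = x % p
    t = x / p
    cancel : ∀ a b → (a + b) - a ≡ b
    cancel = solve-∀

  Q : ℤ
  Q = P q 0ℤ

  P-indicator : ∀ x → P q (+ x) ≡ Q · ind (isZero x p) [mod + p ]
  P-indicator x with x % p in x%p
  ... | zero  = subst (λ c → P q (+ x) ≡ c [mod + p ]) (sym (ℤ.*-identityʳ Q))
                  (P-cong q (subst (λ r → + x ≡ + r [mod + p ]) x%p (residue x)))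
  ... | suc r = mod (subst ((+ p) ∣ˢ_) (sym drop-zero)
                  (P-root q (suc r) (subst (λ r → + x ≡ + r [mod + p ]) x%p (residue x)) (s≤s z≤n)
                     (ℕₚ.≤-pred (subst (_< p) x%p (m%n<n x p)))))
    where
    drop-zero : P q (+ x) - Q · 0ℤ ≡ P q (+ x)
    drop-zero = trans (cong (λ c → P q (+ x) - c) (ℤ.*-zeroʳ Q)) (ℤ.+-identityʳ (P q (+ x)))

  -- p ∤ Q = ±q!, hence p ∤ Qⁿ.
  prime∤Q^ : Prime p → ∀ n → ¬ ((+ p) ∣ˢ Q ^ n)
  prime∤Q^ pr zero    p∣1 = prime∤! pr 0 (s≤s z≤n) (∣⇒∣ᵤ p∣1)
  prime∤Q^ pr (suc n) p∣Q^ with prime∣·⇒ pr Q (Q ^ n) p∣Q^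
  ... | inj₁ p∣Q  = prime∤! pr q (ℕₚ.n<1+n q) (subst (p ℕ∣.∣_) (∣P0∣ q) (∣⇒∣ᵤ p∣Q))
  ... | inj₂ p∣Qⁿ = prime∤Q^ pr n p∣Qⁿ

  module _ {A : Set} where

    Affine : (List A → ℕ) → Set
    Affine L = Σ[ c ∈ (A → ℕ) ] (∀ x S → L (x ∷ S) ≡ c x ℕ.+ L S)

    allDivisible : List (List A → ℕ) → List A → Bool
    allDivisible []       S = true
    allDivisible (L ∷ Ls) S = isZero (L S) p ∧ allDivisible Ls S

    Pprod : List (List A → ℕ) → List A → ℤ
    Pprod []       S = 1ℤ
    Pprod (L ∷ Ls) S = P q (+ L S) · Pprod Ls S

    P-degree : ∀ J (L : List A → ℤ) m → DegBelow 2 J L → DegBelow (suc m) J (λ S → P m (L S))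
    P-degree J L zero    D = Deg-const J 1ℤ
    P-degree J L (suc m) D =
      Deg-· 2 m J (λ S → L S - + suc m) (λ S → P m (L S))
        (Deg-+ 2 J L (λ _ → - + suc m) D (Deg-mono J (λ _ → - + suc m) (s≤s z≤n) (Deg-const J (- + suc m))))
        (P-degree J L m D)

    Pprod-degree : ∀ J Ls → All Affine Ls → DegBelow (suc (length Ls * q)) J (Pprod Ls)
    Pprod-degree J []       []                   = Deg-const J 1ℤ
    Pprod-degree J (L ∷ Ls) ((c , L-step) ∷ affs) =
      Deg-· (suc q) (length Ls * q) J (λ S → P q (+ L S)) (Pprod Ls)
        (P-degree J (λ S → + L S) q
           (Deg-affine J (λ S → + L S) (λ x → + c x) (λ x S → trans (cong +_ (L-step x S)) (ℤ.pos-+ (c x) (L S)))))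
        (Pprod-degree J Ls affs)

    Pprod-indicator : ∀ Ls S → Pprod Ls S ≡ Q ^ length Ls · ind (allDivisible Ls S) [mod + p ]
    Pprod-indicator []       S = mod (divides 0ℤ refl)
    Pprod-indicator (L ∷ Ls) S =
      subst (λ c → Pprod (L ∷ Ls) S ≡ c [mod + p ]) (regroup (isZero (L S) p) (allDivisible Ls S))
        (·shift-mod (P-indicator (L S)) (Pprod-indicator Ls S))
      where
      reassoc : ∀ Q Qⁿ a b → (Q · a) · (Qⁿ · b) ≡ (Q · Qⁿ) · (a · b)
      reassoc = solve-∀
      regroup : ∀ a b → (Q · ind a) · (Q ^ length Ls · ind b) ≡ Q ^ suc (length Ls) · ind (a ∧ b)
      regroup a b = trans (reassoc Q (Q ^ length Ls) (ind a) (ind b)) (cong (Q ^ suc (length Ls) ·_) (sym (ind-∧ a b)))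

    alternating-divisible : Prime p → ∀ Ls → All Affine Ls → ∀ J → suc (length Ls * q) ≤ length J →
      (+ p) ∣ˢ Σsub J (λ S → sign (length S) · ind (allDivisible Ls S))
    alternating-divisible pr Ls affs J n·q<|J| = prime∣·-cancel pr (prime∤Q^ pr (length Ls)) p∣Qⁿ·X
      where
      Qⁿ X : ℤ
      Qⁿ = Q ^ length Ls
      X  = Σsub J (λ S → sign (length S) · ind (allDivisible Ls S))
      expand : ∀ s m c i → s · (m - c · i) ≡ s · m - c · (s · i)
      expand = solve-∀
      error-sum : Σsub J (λ S → sign (length S) · (Pprod Ls S - Qⁿ · ind (allDivisible Ls S))) ≡ - (Qⁿ · X)
      error-sum = begin
        Σsub J (λ S → sign (length S) · (Pprod Ls S - Qⁿ · ind (allDivisible Ls S)))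
          ≡⟨ Σsub-cong J (λ S _ → expand (sign (length S)) (Pprod Ls S) Qⁿ (ind (allDivisible Ls S))) ⟩
        Σsub J (λ S → sign (length S) · Pprod Ls S - Qⁿ · (sign (length S) · ind (allDivisible Ls S)))
          ≡⟨ Σsub-- J _ _ ⟩
        Σsub J (λ S → sign (length S) · Pprod Ls S) - Σsub J (λ S → Qⁿ · (sign (length S) · ind (allDivisible Ls S)))
          ≡⟨ cong₂ _-_ (vanishing _ J (Pprod Ls) (Pprod-degree J Ls affs) n·q<|J|) (Σsub-scale J Qⁿ _) ⟩
        0ℤ - Qⁿ · X
          ≡⟨ ℤ.+-identityˡ _ ⟩
        - (Qⁿ · X) ∎
        where open ≡-Reasoning
      p∣Qⁿ·X : (+ p) ∣ˢ (Qⁿ · X)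
      p∣Qⁿ·X = subst ((+ p) ∣ˢ_) (ℤ.neg-involutive _)
        (∣m⇒∣-m (subst ((+ p) ∣ˢ_) error-sum
          (Σsub-divisible J (+ p) _ (λ S → ∣n⇒∣m*n (sign (length S)) (divides-difference (Pprod-indicator Ls S))))))

eqℕ-refl : ∀ n → eqℕ n n ≡ true
eqℕ-refl zero    = refl
eqℕ-refl (suc n) = eqℕ-refl n

eqℕ-sound : ∀ m n → eqℕ m n ≡ true → m ≡ n
eqℕ-sound zero    zero    _ = refl
eqℕ-sound (suc m) (suc n) e = cong suc (eqℕ-sound m n e)

eqℕ-≢ : ∀ {m n} → m ≢ n → eqℕ m n ≡ false
eqℕ-≢ {m} {n} m≢n with eqℕ m n in e
... | true  = ⊥-elim (m≢n (eqℕ-sound m n e))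
... | false = refl

eqℕ-injective : ∀ (f : ℕ → ℕ) → (∀ {a b} → f a ≡ f b → a ≡ b) → ∀ a b → eqℕ (f a) (f b) ≡ eqℕ a b
eqℕ-injective f f-inj a b with eqℕ a b in e
... | true  rewrite eqℕ-sound a b e = eqℕ-refl (f b)
... | false = eqℕ-≢ (λ fa≡fb → true≢false (trans (sym (eqℕ-refl-at (f-inj fa≡fb))) e))
  where
  eqℕ-refl-at : ∀ {m n} → m ≡ n → eqℕ m n ≡ true
  eqℕ-refl-at {m} refl = eqℕ-refl m
  true≢false : true ≢ false
  true≢false ()

isZero-true : ∀ x n .{{_ : NonZero n}} → x % n ≡ 0 → isZero x n ≡ true
isZero-true x n x%n rewrite x%n = refl

isZero-false : ∀ x n .{{_ : NonZero n}} {r} → x % n ≡ suc r → isZero x n ≡ false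
isZero-false x n x%n rewrite x%n = refl

∧-regroup : ∀ a b c d → a ∧ (b ∧ (c ∧ (d ∧ true))) ≡ (a ∧ (b ∧ c)) ∧ d
∧-regroup true  true  true  d = ∧-identityʳ d
∧-regroup true  true  false d = refl
∧-regroup true  false c     d = refl
∧-regroup false b     c     d = refl

module ZeroSums (q : ℕ) (p-odd : sign (suc q) ≡ -1ℤ) where

  open PolynomialMethod q using (p)

  contribution : Bool → Bool → Bool → Bool → Bool → ℤ
  contribution is0 is1 is2 is3 zs = ((ind is0 - ind (is1 ∧ zs)) + ind (is2 ∧ zs)) - ind (is3 ∧ zs)

  contribution-none : ∀ {is0 is1 is2 is3} zs → is0 ≡ false → is1 ≡ false → is2 ≡ false → is3 ≡ false →
    contribution is0 is1 is2 is3 zs ≡ 0ℤ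
  contribution-none zs refl refl refl refl = refl

  sign-multiple : ∀ t → sign (t * p) ≡ sign t
  sign-multiple t = begin
    sign (t * p)   ≡⟨ cong sign (ℕₚ.*-comm t p) ⟩
    sign (p * t)   ≡⟨ sym (ℤ.^-*-assoc -1ℤ p t) ⟩
    sign p ^ t     ≡⟨ cong (_^ t) p-odd ⟩
    sign t         ∎
    where open ≡-Reasoning

  eqℕ-multiple : ∀ t k → eqℕ (t * p) (k * p) ≡ eqℕ t k
  eqℕ-multiple = eqℕ-injective (_* p) (λ {a} {b} → ℕₚ.*-cancelʳ-≡ a b p)

  eqℕ-multiple-p : ∀ t → eqℕ (t * p) p ≡ eqℕ t 1
  eqℕ-multiple-p t = trans (cong (eqℕ (t * p)) (sym (ℕₚ.*-identityˡ p))) (eqℕ-multiple t 1)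

  -- The identity for lengths 0, p, 2p, 3p, after dividing the length by p.
  small-identity : ∀ t zs → t < 4 → (t ≡ 0 → zs ≡ true) →
    sign t · ind (zs ∧ true) ≡ contribution (eqℕ t 0) (eqℕ t 1) (eqℕ t 2) (eqℕ t 3) zs
  small-identity 0 zs _ empty-zs rewrite empty-zs refl = refl
  small-identity 1 true  _ _ = refl
  small-identity 1 false _ _ = refl
  small-identity 2 true  _ _ = refl
  small-identity 2 false _ _ = refl
  small-identity 3 true  _ _ = refl
  small-identity 3 false _ _ = refl
  small-identity (suc (suc (suc (suc t)))) zs (s≤s (s≤s (s≤s (s≤s ())))) _

  multiple-identity : ∀ t zs → t < 4 → (t * p ≡ 0 → zs ≡ true) →
    sign (t * p) · ind (zs ∧ isZero (t * p) p)
      ≡ contribution (eqℕ (t * p) 0) (eqℕ (t * p) p) (eqℕ (t * p) (2 * p)) (eqℕ (t * p) (3 * p)) zs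
  multiple-identity t zs t<4 empty-zs
    rewrite sign-multiple t | isZero-true (t * p) p (m*n%n≡0 t p)
          | eqℕ-multiple t 0 | eqℕ-multiple-p t | eqℕ-multiple t 2 | eqℕ-multiple t 3
    = small-identity t zs t<4 (λ t≡0 → empty-zs (cong (_* p) t≡0))

  not-multiple : ∀ l {r} → l % p ≡ suc r → ∀ k → l ≢ k * p
  not-multiple l l%p k l≡k*p with trans (sym (trans (cong (_% p) l≡k*p) (m*n%n≡0 k p))) l%p
  ... | ()

  length-identity : ∀ l zs → l < 4 * p → (l ≡ 0 → zs ≡ true) →
    sign l · ind (zs ∧ isZero l p) ≡ contribution (eqℕ l 0) (eqℕ l p) (eqℕ l (2 * p)) (eqℕ l (3 * p)) zs
  length-identity l zs l<4p empty-zs = by-residue (l % p) refl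
    where
    Goal : ℕ → Set
    Goal n = sign n · ind (zs ∧ isZero n p) ≡ contribution (eqℕ n 0) (eqℕ n p) (eqℕ n (2 * p)) (eqℕ n (3 * p)) zs
    by-residue : ∀ r → l % p ≡ r → Goal l
    by-residue zero l%p =
      subst Goal (sym l≡t*p)
        (multiple-identity t zs (ℕₚ.*-cancelʳ-< p t 4 (subst (_< 4 * p) l≡t*p l<4p))
           (λ t*p≡0 → empty-zs (trans l≡t*p t*p≡0)))
      where
      t : ℕ
      t = l / p
      l≡t*p : l ≡ t * p
      l≡t*p = trans (m≡m%n+[m/n]*n l p) (cong (ℕ._+ t * p) l%p)
    by-residue (suc r) l%p = begin
      sign l · ind (zs ∧ isZero l p)   ≡⟨ cong (λ b → sign l · ind (zs ∧ b)) (isZero-false l p l%p) ⟩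
      sign l · ind (zs ∧ false)        ≡⟨ cong (λ b → sign l · ind b) (∧-zeroʳ zs) ⟩
      sign l · 0ℤ                      ≡⟨ ℤ.*-zeroʳ (sign l) ⟩
      0ℤ                               ≡⟨ sym (contribution-none zs
                                               (eqℕ-≢ (not-multiple l l%p 0))
                                               (eqℕ-≢ (λ l≡p → not-multiple l l%p 1 (trans l≡p (sym (ℕₚ.*-identityˡ p)))))
                                               (eqℕ-≢ (not-multiple l l%p 2)) (eqℕ-≢ (not-multiple l l%p 3))) ⟩
      contribution (eqℕ l 0) (eqℕ l p) (eqℕ l (2 * p)) (eqℕ l (3 * p)) zs ∎
      where open ≡-Reasoning

  empty-zero-sum : ∀ (S : List (Elem3 p)) → length S ≡ 0 → isZeroSum p S ≡ true
  empty-zero-sum [] _ = refl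

  alternating-count : ∀ J → length J < 4 * p →
    Σsub J (λ S → sign (length S) · ind (isZeroSum p S ∧ isZero (length S) p))
      ≡ ((+ 1 - (+ zsCount p p J)) + (+ zsCount p (2 * p) J)) - (+ zsCount p (3 * p) J)
  alternating-count J |J|<4p = begin
    Σsub J (λ S → sign (length S) · ind (isZeroSum p S ∧ isZero (length S) p))
      ≡⟨ Σsub-cong J (λ S S≤J → length-identity (length S) (isZeroSum p S)
                                   (ℕₚ.≤-<-trans S≤J |J|<4p) (empty-zero-sum S)) ⟩
    Σsub J (λ S → ((empty S - has 1 S) + has 2 S) - has 3 S)
      ≡⟨ Σsub-- J _ (has 3) ⟩
    Σsub J (λ S → (empty S - has 1 S) + has 2 S) - Σsub J (has 3)
      ≡⟨ cong (_- Σsub J (has 3)) (trans (Σsub-+ J _ (has 2)) (cong (_+ Σsub J (has 2)) (Σsub-- J empty (has 1)))) ⟩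
    ((Σsub J empty - Σsub J (has 1)) + Σsub J (has 2)) - Σsub J (has 3)
      ≡⟨ cong₂ _-_ (cong₂ _+_ (cong₂ _-_ (Σsub-empty J) (sym (count-Σsub (zeroSumOfLength 1) J)))
                              (sym (count-Σsub (zeroSumOfLength 2) J)))
                   (sym (count-Σsub (zeroSumOfLength 3) J)) ⟩
    ((+ 1 - (+ zsCount p p J)) + (+ zsCount p (2 * p) J)) - (+ zsCount p (3 * p) J) ∎
    where
    open ≡-Reasoning
    -- The statement writes the length p itself rather than 1 * p.
    multiple : ℕ → ℕ
    multiple 1 = p
    multiple k = k * p
    zeroSumOfLength : ℕ → List (Elem3 p) → Bool
    zeroSumOfLength k S = eqℕ (length S) (multiple k) ∧ isZeroSum p S
    empty : List (Elem3 p) → ℤ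
    has : ℕ → List (Elem3 p) → ℤ
    empty S = ind (eqℕ (length S) 0)
    has k S = ind (zeroSumOfLength k S)

module Forms (q : ℕ) where

  open PolynomialMethod q using (p; Affine; allDivisible)

  σ₁ σ₂ σ₃ : List (Elem3 p) → ℕ
  σ₁ S = proj₁ (sumCoords S)
  σ₂ S = proj₁ (proj₂ (sumCoords S))
  σ₃ S = proj₂ (proj₂ (sumCoords S))

  forms : List (List (Elem3 p) → ℕ)
  forms = σ₁ ∷ σ₂ ∷ σ₃ ∷ length ∷ []

  forms-affine : All Affine forms
  forms-affine = ((λ x → toℕ (proj₁ x))         , λ _ _ → refl)
               ∷ ((λ x → toℕ (proj₁ (proj₂ x))) , λ _ _ → refl)
               ∷ ((λ x → toℕ (proj₂ (proj₂ x))) , λ _ _ → refl)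
               ∷ ((λ _ → 1)                     , λ _ _ → refl)
               ∷ []

  allDivisible-forms : ∀ S → allDivisible forms S ≡ isZeroSum p S ∧ isZero (length S) p
  allDivisible-forms S = ∧-regroup (isZero (σ₁ S) p) (isZero (σ₂ S) p) (isZero (σ₃ S) p) (isZero (length S) p)

length-range : ∀ q n → n ≡ 4 * suc q ∸ 3 ⊎ n ≡ 4 * suc q ∸ 2 ⊎ n ≡ 4 * suc q ∸ 1 →
  suc (4 * q) ≤ n × n < 4 * suc q
length-range q n n∈ =
  map₂ (subst (n <_) (sym 4p≡4+4q)) (range (4 * q) (subst (λ m → n ≡ m ∸ 3 ⊎ n ≡ m ∸ 2 ⊎ n ≡ m ∸ 1) 4p≡4+4q n∈))
  where
  4p≡4+4q : 4 * suc q ≡ 4 ℕ.+ 4 * q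
  4p≡4+4q = ℕₚ.*-suc 4 q
  range : ∀ N → n ≡ 4 ℕ.+ N ∸ 3 ⊎ n ≡ 4 ℕ.+ N ∸ 2 ⊎ n ≡ 4 ℕ.+ N ∸ 1 → suc N ≤ n × n < 4 ℕ.+ N
  range N (inj₁ refl)        = ℕₚ.≤-refl , ℕₚ.m≤n⇒m≤1+n (ℕₚ.n≤1+n _)
  range N (inj₂ (inj₁ refl)) = ℕₚ.n≤1+n _ , ℕₚ.n≤1+n _
  range N (inj₂ (inj₂ refl)) = ℕₚ.m≤n⇒m≤1+n (ℕₚ.n≤1+n _) , ℕₚ.≤-refl

corollary5p3 : (p : ℕ) → .{{_ : NonZero p}} → Prime p → p > 3 →
    (J : List (Elem3 p)) →
    (length J ≡ 4 * p ∸ 3 ⊎ length J ≡ 4 * p ∸ 2 ⊎ length J ≡ 4 * p ∸ 1) →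
    (+ p) ∣ (((+ 1 - (+ zsCount p p J)) + (+ zsCount p (2 * p) J)) - (+ zsCount p (3 * p) J))
corollary5p3 (suc q) p-prime 3<p J |J|∈ =
  ∣⇒∣ᵤ (subst ((+ suc q) ∣ˢ_) alternating-sum (alternating-divisible p-prime forms forms-affine J (proj₁ bounds)))
  where
  open PolynomialMethod q
  open Forms q
  open ZeroSums q (sign-oddPrime p-prime (ℕₚ.<-trans (ℕₚ.n<1+n 2) 3<p))
  bounds : suc (4 * q) ≤ length J × length J < 4 * p
  bounds = length-range q (length J) |J|∈
  alternating-sum : Σsub J (λ S → sign (length S) · ind (allDivisible forms S))
                    ≡ ((+ 1 - (+ zsCount p p J)) + (+ zsCount p (2 * p) J)) - (+ zsCount p (3 * p) J)
  alternating-sum =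
    trans (Σsub-cong J (λ S _ → cong (λ b → sign (length S) · ind b) (allDivisible-forms S)))
          (alternating-count J (proj₂ bounds))
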